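{- Let $n\ge1$, let $\Delta^+$ be the positive roots of type $A_n$ with the root order, let $\mathfrak X$ be the reverse operator on $\mathrm{AN}(\Delta^+)$ and $\Gamma\mapsto\Gamma^*$ the duality on $\mathrm{AN}(\Delta^+)$. Then for every $\Gamma\in\mathrm{AN}(\Delta^+)$ one has $\mathfrak X(\Gamma)^*=\mathfrak X^{ -1}(\Gamma^*)$.
   Context: Write $\Delta^+=\{\varepsilon_i-\varepsilon_{j+1}\mid 1\le i\le j\le n\}$ with simple roots $\alpha_i=\varepsilon_i-\varepsilon_{i+1}$, and denote the root $\alpha_i+\dots+\alpha_j=\varepsilon_i-\varepsilon_{j+1}$ by $(i,j)$. The root order is $x\preccurlyeq y$ iff $y-x$ is a non-negative integral combination of simple roots. An antichain is a set of mutually incomparable roots (including $\varnothing$); $\mathrm{AN}(\Delta^+)$ is the set of antichains. For $\Gamma$ an antichain, $\mathcal I(\Gamma)=\{x\in\Delta^+\mid\exists\gamma\in\Gamma,\ \gamma\preccurlyeq x\}$; for a subset $S$, $S_{max}$ is its set of maximal elements. The reverse operator is $\mathfrak X(\Gamma)=(\Delta^+\setminus\mathcal I(\Gamma))_{max}$; it is a bijection. A set $\Gamma=\{(i_1,j_1),\dots,(i_k,j_k)\}$ with $i_1<\dots<i_k$ is an antichain iff $j_1<\dots<j_k$ and $i_s\le j_s$ for all $s$; thus an antichain is encoded by the pair of strictly increasing sequences $\mathbf i=(i_1,\dots,i_k)$, $\mathbf j=(j_1,\dots,j_k)$ in $[n]=\{1,\dots,n\}$ with $\mathbf i\le\mathbf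 j$ componentwise. Duality: $\Gamma^*$ is the antichain whose sequences are $\mathbf i^*=[n]\setminus\mathbf j$ and $\mathbf j^*=[n]\setminus\mathbf i$ (each listed increasingly and paired in order); this is again an antichain and $\ast$ is an involution of $\mathrm{AN}(\Delta^+)$. -}

module Defs where

open import Data.Bool using (Bool; true; false; _∧_; _∨_; not; if_then_else_)
open import Data.Nat using (ℕ; zero; suc; _+_; _≤ᵇ_; _<ᵇ_; _≡ᵇ_)
open import Data.Fin using (Fin; toℕ)
open import Data.List using (List; allFin; foldr; map)
open import Relation.Binary.PropositionalEquality using (_≡_)

-- Conventions: the index set [n] = {1,…,n} is represented by Fin n = {0,…,n-1}.
-- A pair (i , j) : Fin n × Fin n stands for the root (i,j) = α_i + … + α_j,
-- which is a positive root iff i ≤ j.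
-- Sets of roots are decidable (Bool-valued) predicates on pairs (i , j);
-- pairs with i > j are not roots and must not belong to a set of roots.

RootSet : ℕ → Set
RootSet n = Fin n → Fin n → Bool

_≤F_ : ∀ {n} → Fin n → Fin n → Bool
a ≤F b = toℕ a ≤ᵇ toℕ b

_<F_ : ∀ {n} → Fin n → Fin n → Bool
a <F b = toℕ a <ᵇ toℕ b

_==F_ : ∀ {n} → Fin n → Fin n → Bool
a ==F b = toℕ a ≡ᵇ toℕ b

anyF : ∀ {n} → (Fin n → Bool) → Bool
anyF {n} p = foldr (λ d r → p d ∨ r) false (allFin n)

allF : ∀ {n} → (Fin n → Bool) → Bool
allF {n} p = foldr (λ d r → p d ∧ r) true (allFin n)

isRoot : ∀ {n} → Fin n → Fin n → Bool
isRoot i j = i ≤F j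

coef : ∀ {n} → Fin n → Fin n → Fin n → ℕ
coef i j k = if (i ≤F k) ∧ (k ≤F j) then 1 else 0

-- root order: x ≼ y iff y - x is a non-negative integral combination of
-- simple roots, i.e. every simple-root coefficient of x is ≤ that of y
-- (the simple roots form a basis).
prec : ∀ {n} → Fin n → Fin n → Fin n → Fin n → Bool
prec i j i' j' = allF (λ k → coef i j k ≤ᵇ coef i' j' k)

upset : ∀ {n} → RootSet n → RootSet n
upset Γ i j = anyF (λ a → anyF (λ b → Γ a b ∧ isRoot a b ∧ prec a b i j))

complUp : ∀ {n} → RootSet n → RootSet n
complUp Γ i j = isRoot i j ∧ not (upset Γ i j)

maxElems : ∀ {n} → RootSet n → RootSet n
maxElems S i j =
  S i j ∧ allF (λ a → allF (λ b →
    not (S a b ∧ prec i j a b) ∨ ((a ==F i) ∧ (b ==F j))))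

revOp : ∀ {n} → RootSet n → RootSet n
revOp Γ = maxElems (complUp Γ)

IsAntichain : ∀ {n} → RootSet n → Set
IsAntichain {n} Γ =
  (∀ (i j : Fin n) → Γ i j ≡ true → isRoot i j ≡ true) ×'
  (∀ (i j i' j' : Fin n) → Γ i j ≡ true → Γ i' j' ≡ true →
     prec i j i' j' ≡ true → (i ≡ i') ×' (j ≡ j'))
  where
  open import Data.Product using () renaming (_×_ to _×'_)

-- sequences 𝐢 and 𝐣 of an antichain (as subsets of [n])
firstIdx : ∀ {n} → RootSet n → Fin n → Bool
firstIdx Γ a = anyF (λ b → Γ a b)

secondIdx : ∀ {n} → RootSet n → Fin n → Bool
secondIdx Γ b = anyF (λ a → Γ a b)

-- rank c of an element of a subset P: number of elements of P smaller than c
-- (so the element of rank s is the (s+1)-st in increasing order)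
rank : ∀ {n} → (Fin n → Bool) → Fin n → ℕ
rank {n} P c =
  foldr (λ d r → (if P d ∧ (d <F c) then 1 else 0) + r) 0 (allFin n)

-- duality Γ*: 𝐢* = [n] ∖ 𝐣, 𝐣* = [n] ∖ 𝐢, listed increasingly and paired in
-- order, i.e. (a , b) ∈ Γ* iff a ∉ 𝐣, b ∉ 𝐢 and a, b have the same position
-- in their respective increasing listings.
dual : ∀ {n} → RootSet n → RootSet n
dual Γ a b =
  not (secondIdx Γ a) ∧ not (firstIdx Γ b) ∧
  (rank (λ c → not (secondIdx Γ c)) a ≡ᵇ rank (λ c → not (firstIdx Γ c)) b)

_≐_ : ∀ {n} → RootSet n → RootSet n → Set
_≐_ {n} S T = ∀ (i j : Fin n) → S i j ≡ T i j

-- An antichain is determined by its index sequences 𝐢 and 𝐣: its s-th smallest first index is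
-- paired with its s-th smallest second index. Both operators act on these sequences by simple rules.
-- The elements of 𝔛(Γ) are the maximal intervals [c,d] containing no root of Γ, so c ∈ 𝐢(𝔛(Γ)) iff
-- (c,c) ∉ Γ and (c = 1 or c−1 ∈ 𝐢), and d ∈ 𝐣(𝔛(Γ)) iff (d,d) ∉ Γ and (d = n or d+1 ∈ 𝐣).
-- Duality gives 𝐢(Γ*) = [n]∖𝐣 and 𝐣(Γ*) = [n]∖𝐢, and puts (c,c) into Γ* iff no root of Γ contains
-- α_c; for Γ = 𝔛(Γ₀) the latter happens iff (c,c) ∈ Γ₀. Composing these rules, and using that an
-- antichain containing a root (a,c) with a < c cannot contain (c−1,c−1) (and symmetrically), shows
-- that 𝔛(𝔛(Γ)*) has the index sequences [n]∖𝐣 and [n]∖𝐢 of Γ*.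

module Submission where

open import Defs
open import Data.Bool using (Bool; true; false; _∧_; _∨_; not; if_then_else_)
open import Data.Bool.Properties using (T-≡) renaming (_≟_ to _≟ᴮ_)
open import Data.Empty using (⊥; ⊥-elim)
open import Data.Fin using (Fin; toℕ; fromℕ<; punchIn) renaming (zero to fzero; suc to fsuc)
open import Data.Fin.Properties using (toℕ-injective; toℕ<n; toℕ-fromℕ<; punchInᵢ≢i)
open import Data.List using ([]; _∷_; foldr; allFin; tabulate)
open import Data.List.Membership.Propositional using (_∈_)
open import Data.List.Membership.Propositional.Properties using (∈-allFin)
open import Data.List.Relation.Unary.Any using (here; there)
open import Data.Nat
  using (ℕ; zero; suc; pred; _+_; _∸_; _≤_; _<_; _≤′_; ≤′-refl; ≤′-step; z≤n; s≤s;
         _≤ᵇ_; _<ᵇ_; _≡ᵇ_)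
open import Data.Nat.Properties
open import Algebra.Properties.CommutativeMonoid.Sum +-0-commutativeMonoid
  using (sum; sum-cong-≗; ∑-distrib-+; sum-remove)
open import Data.Product using (_×_; _,_; proj₁; proj₂; ∃-syntax)
open import Data.Sum using (_⊎_; inj₁; inj₂; [_,_])
open import Function using (_∘′_; case_of_)
open import Function.Bundles using (Equivalence)
open import Relation.Binary.Definitions using (tri<; tri≈; tri>)
open import Relation.Binary.PropositionalEquality hiding ([_]; J)
open import Relation.Nullary using (¬_; yes; no; Dec)
open import Relation.Nullary.Decidable using (decidable-stable)

∧-true⁻ˡ : ∀ {a b} → a ∧ b ≡ true → a ≡ true
∧-true⁻ˡ {true} _ = refl

∧-true⁻ʳ : ∀ {a b} → a ∧ b ≡ true → b ≡ true
∧-true⁻ʳ {true} e = e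

∧-true⁺ : ∀ {a b} → a ≡ true → b ≡ true → a ∧ b ≡ true
∧-true⁺ refl refl = refl

∨-true⁻ : ∀ {a b} → a ∨ b ≡ true → a ≡ true ⊎ b ≡ true
∨-true⁻ {true} _ = inj₁ refl
∨-true⁻ {false} e = inj₂ e

∨-true⁺ˡ : ∀ {a b} → a ≡ true → a ∨ b ≡ true
∨-true⁺ˡ refl = refl

∨-true⁺ʳ : ∀ {a b} → b ≡ true → a ∨ b ≡ true
∨-true⁺ʳ {true} _ = refl
∨-true⁺ʳ {false} e = e

not-true⁻ : ∀ {a} → not a ≡ true → ¬ (a ≡ true)
not-true⁻ {false} _ ()

not-true⁺ : ∀ {a} → ¬ (a ≡ true) → not a ≡ true
not-true⁺ {true} h = ⊥-elim (h refl)
not-true⁺ {false} _ = refl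

bool-ext : ∀ {a b} → (a ≡ true → b ≡ true) → (b ≡ true → a ≡ true) → a ≡ b
bool-ext {true} f g = sym (f refl)
bool-ext {false} {true} f g = g refl
bool-ext {false} {false} f g = refl

≤ᵇ-true⁺ : ∀ {m k} → m ≤ k → (m ≤ᵇ k) ≡ true
≤ᵇ-true⁺ p = Equivalence.to T-≡ (≤⇒≤ᵇ p)

≤ᵇ-true⁻ : ∀ {m k} → (m ≤ᵇ k) ≡ true → m ≤ k
≤ᵇ-true⁻ {m} {k} e = ≤ᵇ⇒≤ m k (Equivalence.from T-≡ e)

<ᵇ-true⁺ : ∀ {m k} → m < k → (m <ᵇ k) ≡ true
<ᵇ-true⁺ p = Equivalence.to T-≡ (<⇒<ᵇ p)

<ᵇ-false⁺ : ∀ {m k} → ¬ (m < k) → (m <ᵇ k) ≡ false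
<ᵇ-false⁺ {m} {k} h with m <ᵇ k in e
... | true = ⊥-elim (h (<ᵇ⇒< m k (Equivalence.from T-≡ e)))
... | false = refl

≡ᵇ-true⁺ : ∀ {m k} → m ≡ k → (m ≡ᵇ k) ≡ true
≡ᵇ-true⁺ {m} {k} p = Equivalence.to T-≡ (≡⇒≡ᵇ m k p)

≡ᵇ-true⁻ : ∀ {m k} → (m ≡ᵇ k) ≡ true → m ≡ k
≡ᵇ-true⁻ {m} {k} e = ≡ᵇ⇒≡ m k (Equivalence.from T-≡ e)

≡ᵇ-false⁺ : ∀ {m k} → ¬ (m ≡ k) → (m ≡ᵇ k) ≡ false
≡ᵇ-false⁺ {m} {k} h with m ≡ᵇ k in e
... | true = ⊥-elim (h (≡ᵇ-true⁻ e))
... | false = refl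

module _ {A : Set} (p : A → Bool) where

  foldr-∨-true⁻ : ∀ xs → foldr (λ d r → p d ∨ r) false xs ≡ true → ∃[ x ] p x ≡ true
  foldr-∨-true⁻ (x ∷ xs) e with ∨-true⁻ {p x} e
  ... | inj₁ px = x , px
  ... | inj₂ rest = foldr-∨-true⁻ xs rest

  foldr-∨-true⁺ : ∀ {x} xs → x ∈ xs → p x ≡ true → foldr (λ d r → p d ∨ r) false xs ≡ true
  foldr-∨-true⁺ (y ∷ xs) (here refl) px = ∨-true⁺ˡ px
  foldr-∨-true⁺ (y ∷ xs) (there x∈xs) px = ∨-true⁺ʳ {p y} (foldr-∨-true⁺ xs x∈xs px)

  foldr-∧-true⁻ : ∀ {x} xs → foldr (λ d r → p d ∧ r) true xs ≡ true → x ∈ xs → p x ≡ true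
  foldr-∧-true⁻ (y ∷ xs) e (here refl) = ∧-true⁻ˡ e
  foldr-∧-true⁻ (y ∷ xs) e (there x∈xs) = foldr-∧-true⁻ xs (∧-true⁻ʳ {p y} e) x∈xs

  foldr-∧-true⁺ : ∀ xs → (∀ x → p x ≡ true) → foldr (λ d r → p d ∧ r) true xs ≡ true
  foldr-∧-true⁺ [] h = refl
  foldr-∧-true⁺ (x ∷ xs) h = ∧-true⁺ (h x) (foldr-∧-true⁺ xs h)

module _ {n} (p : Fin n → Bool) where

  anyF-true⁻ : anyF p ≡ true → ∃[ d ] p d ≡ true
  anyF-true⁻ = foldr-∨-true⁻ p (allFin n)

  anyF-true⁺ : ∀ d → p d ≡ true → anyF p ≡ true
  anyF-true⁺ d = foldr-∨-true⁺ p (allFin n) (∈-allFin d)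

  allF-true⁻ : allF p ≡ true → ∀ d → p d ≡ true
  allF-true⁻ e d = foldr-∧-true⁻ p (allFin n) e (∈-allFin d)

  allF-true⁺ : (∀ d → p d ≡ true) → allF p ≡ true
  allF-true⁺ = foldr-∧-true⁺ p (allFin n)

indicator : Bool → ℕ
indicator b = if b then 1 else 0

foldr-+-tabulate : ∀ {A : Set} m (f : Fin m → A) (g : A → ℕ) →
  foldr (λ d r → g d + r) 0 (tabulate f) ≡ sum (λ k → g (f k))
foldr-+-tabulate zero f g = refl
foldr-+-tabulate (suc m) f g = cong (g (f fzero) +_) (foldr-+-tabulate m (f ∘′ fsuc) g)

sum-zero : ∀ {m} (g : Fin m → ℕ) → (∀ d → g d ≡ 0) → sum g ≡ 0
sum-zero {zero} g z = refl
sum-zero {suc m} g z = cong₂ _+_ (z fzero) (sum-zero (g ∘′ fsuc) (λ d → z (fsuc d)))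

sum-concentrated : ∀ {m} (g : Fin m → ℕ) d₀ → (∀ d → d ≢ d₀ → g d ≡ 0) → sum g ≡ g d₀
sum-concentrated {suc m} g d₀ z = begin
  sum g                                ≡⟨ sum-remove g ⟩
  g d₀ + sum (λ k → g (punchIn d₀ k))  ≡⟨ cong (g d₀ +_) (sum-zero _ λ k → z _ (punchInᵢ≢i d₀ k)) ⟩
  g d₀ + 0                             ≡⟨ +-identityʳ (g d₀) ⟩
  g d₀                                 ∎
  where open ≡-Reasoning

-- rank P c unfolds to countBelow P (toℕ c); a numeric bound also allows counting below n.
countBelow : ∀ {n} → (Fin n → Bool) → ℕ → ℕ
countBelow {n} P m = foldr (λ d r → indicator (P d ∧ (toℕ d <ᵇ m)) + r) 0 (allFin n)

module _ {n} (P : Fin n → Bool) where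

  private
    below at : ℕ → Fin n → ℕ
    below m d = indicator (P d ∧ (toℕ d <ᵇ m))
    at m d = indicator (P d ∧ (toℕ d ≡ᵇ m))

    countBelow-sum : ∀ m → countBelow P m ≡ sum (below m)
    countBelow-sum m = foldr-+-tabulate n (λ d → d) (below m)

    below-suc : ∀ m d → below (suc m) d ≡ below m d + at m d
    below-suc m d with P d | <-cmp (toℕ d) m
    ... | false | _ = refl
    ... | true | tri< d<m d≢m _
      rewrite <ᵇ-true⁺ (m<n⇒m<1+n d<m) | <ᵇ-true⁺ d<m | ≡ᵇ-false⁺ d≢m = refl
    ... | true | tri≈ d≮m d≡m _
      rewrite <ᵇ-true⁺ (≤-reflexive (cong suc d≡m)) | <ᵇ-false⁺ d≮m | ≡ᵇ-true⁺ d≡m = refl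
    ... | true | tri> d≮m d≢m m<d
      rewrite <ᵇ-false⁺ (<⇒≱ m<d ∘′ ≤-pred) | <ᵇ-false⁺ d≮m | ≡ᵇ-false⁺ d≢m = refl

    countBelow-suc : ∀ m → countBelow P (suc m) ≡ countBelow P m + sum (at m)
    countBelow-suc m = begin
      countBelow P (suc m)        ≡⟨ countBelow-sum (suc m) ⟩
      sum (below (suc m))         ≡⟨ sum-cong-≗ (below-suc m) ⟩
      sum (λ d → below m d + at m d) ≡⟨ ∑-distrib-+ (below m) (at m) ⟩
      sum (below m) + sum (at m)  ≡⟨ cong (_+ sum (at m)) (countBelow-sum m) ⟨
      countBelow P m + sum (at m) ∎
      where open ≡-Reasoning

  countBelow-zero : countBelow P 0 ≡ 0
  countBelow-zero = trans (countBelow-sum 0) (sum-zero _ zero-below)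
    where
    zero-below : ∀ d → below 0 d ≡ 0
    zero-below d with P d
    ... | false = refl
    ... | true = refl

  countBelow-at : ∀ d → countBelow P (suc (toℕ d)) ≡ countBelow P (toℕ d) + indicator (P d)
  countBelow-at d₀ = trans (countBelow-suc (toℕ d₀))
    (cong (countBelow P (toℕ d₀) +_) (trans (sum-concentrated _ d₀ off-d₀) at-d₀))
    where
    off-d₀ : ∀ d → d ≢ d₀ → at (toℕ d₀) d ≡ 0
    off-d₀ d d≢d₀ with P d
    ... | false = refl
    ... | true rewrite ≡ᵇ-false⁺ (d≢d₀ ∘′ toℕ-injective) = refl
    at-d₀ : at (toℕ d₀) d₀ ≡ indicator (P d₀)
    at-d₀ rewrite ≡ᵇ-true⁺ (refl {x = toℕ d₀}) with P d₀
    ... | false = refl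
    ... | true = refl

  countBelow-beyond : ∀ m → n ≤ m → countBelow P (suc m) ≡ countBelow P m
  countBelow-beyond m n≤m = trans (countBelow-suc m)
    (trans (cong (countBelow P m +_) (sum-zero _ nowhere)) (+-identityʳ _))
    where
    nowhere : ∀ d → at m d ≡ 0
    nowhere d with P d
    ... | false = refl
    ... | true rewrite ≡ᵇ-false⁺ (<⇒≢ (<-≤-trans (toℕ<n d) n≤m)) = refl

  private
    countBelow-at′ : ∀ {b} d → P d ≡ b → countBelow P (suc (toℕ d)) ≡ countBelow P (toℕ d) + indicator b
    countBelow-at′ d Pd≡b = trans (countBelow-at d) (cong (λ b → countBelow P (toℕ d) + indicator b) Pd≡b)

    data Step (m : ℕ) : Set where
      skip : countBelow P (suc m) ≡ countBelow P m → (∀ d → toℕ d ≡ m → P d ≢ true) → Step m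
      hit  : ∀ d → toℕ d ≡ m → P d ≡ true → countBelow P (suc m) ≡ suc (countBelow P m) → Step m

    stepAt : ∀ {m} (d : Fin n) → toℕ d ≡ m → Step m
    stepAt d refl with P d in Pd
    ... | true = hit d refl Pd (trans (countBelow-at′ d Pd) (+-comm _ 1))
    ... | false = skip (trans (countBelow-at′ d Pd) (+-identityʳ _))
      λ d′ d′≡d Pd′ → case trans (sym Pd) (subst (λ x → P x ≡ true) (toℕ-injective d′≡d) Pd′) of λ ()

    step : ∀ m → Step m
    step m with m <? n
    ... | no m≮n = skip (countBelow-beyond m (≮⇒≥ m≮n)) λ d d≡m _ → m≮n (subst (_< n) d≡m (toℕ<n d))
    ... | yes m<n = stepAt (fromℕ< m<n) (toℕ-fromℕ< m<n)

  countBelow-≤-suc : ∀ m → countBelow P m ≤ countBelow P (suc m)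
  countBelow-≤-suc m with step m
  ... | skip e _ = ≤-reflexive (sym e)
  ... | hit _ _ _ e = subst (countBelow P m ≤_) (sym e) (n≤1+n _)

  countBelow-mono : ∀ {m k} → m ≤ k → countBelow P m ≤ countBelow P k
  countBelow-mono = mono′ ∘′ ≤⇒≤′
    where
    mono′ : ∀ {m k} → m ≤′ k → countBelow P m ≤ countBelow P k
    mono′ ≤′-refl = ≤-refl
    mono′ (≤′-step m≤′k) = ≤-trans (mono′ m≤′k) (countBelow-≤-suc _)

  countBelow-hit : ∀ d → P d ≡ true → countBelow P (suc (toℕ d)) ≡ suc (countBelow P (toℕ d))
  countBelow-hit d Pd with step (toℕ d)
  ... | skip _ none = ⊥-elim (none d refl Pd)
  ... | hit _ _ _ e = e

  countBelow-strict : ∀ d {m} → P d ≡ true → toℕ d < m → countBelow P (toℕ d) < countBelow P m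
  countBelow-strict d Pd d<m = subst (_≤ _) (countBelow-hit d Pd) (countBelow-mono d<m)

  countBelow-injective : ∀ d d′ → P d ≡ true → P d′ ≡ true →
    countBelow P (toℕ d) ≡ countBelow P (toℕ d′) → d ≡ d′
  countBelow-injective d d′ Pd Pd′ e with <-cmp (toℕ d) (toℕ d′)
  ... | tri< d<d′ _ _ = ⊥-elim (<⇒≢ (countBelow-strict d Pd d<d′) e)
  ... | tri≈ _ d≡d′ _ = toℕ-injective d≡d′
  ... | tri> _ _ d′<d = ⊥-elim (<⇒≢ (countBelow-strict d′ Pd′ d′<d) (sym e))

  countBelow-attained : ∀ m r → r < countBelow P m →
    ∃[ d ] P d ≡ true × toℕ d < m × countBelow P (toℕ d) ≡ r
  countBelow-attained zero r r<0 = ⊥-elim (n≮0 (subst (r <_) countBelow-zero r<0))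
  countBelow-attained (suc m) r r<c with step m
  ... | skip e _ = widen (countBelow-attained m r (subst (r <_) e r<c))
    where
    widen : (∃[ d ] P d ≡ true × toℕ d < m × countBelow P (toℕ d) ≡ r) →
            ∃[ d ] P d ≡ true × toℕ d < suc m × countBelow P (toℕ d) ≡ r
    widen (d , Pd , d<m , e) = d , Pd , m<n⇒m<1+n d<m , e
  ... | hit d₀ d₀≡m Pd₀ e with m<1+n⇒m<n∨m≡n (subst (r <_) e r<c)
  ...   | inj₂ r≡c = d₀ , Pd₀ , ≤-reflexive (cong suc d₀≡m) , trans (cong (countBelow P) d₀≡m) (sym r≡c)
  ...   | inj₁ r<c′ with countBelow-attained m r r<c′
  ...     | d , Pd , d<m , e′ = d , Pd , m<n⇒m<1+n d<m , e′

countBelow-cong : ∀ {n} {P Q : Fin n → Bool} → (∀ d → P d ≡ Q d) → ∀ m → countBelow P m ≡ countBelow Q m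
countBelow-cong {n} {P} {Q} P≗Q m = go (allFin n)
  where
  go : ∀ xs → foldr (λ d r → indicator (P d ∧ (toℕ d <ᵇ m)) + r) 0 xs
            ≡ foldr (λ d r → indicator (Q d ∧ (toℕ d <ᵇ m)) + r) 0 xs
  go [] = refl
  go (d ∷ xs) = cong₂ _+_ (cong (λ b → indicator (b ∧ (toℕ d <ᵇ m))) (P≗Q d)) (go xs)

countBelow-complement : ∀ {n} (P : Fin n → Bool) m → m ≤ n →
  countBelow (not ∘′ P) m + countBelow P m ≡ m
countBelow-complement P zero _ = cong₂ _+_ (countBelow-zero (not ∘′ P)) (countBelow-zero P)
countBelow-complement P (suc m) m<n =
  trans (subst (λ k → countBelow (not ∘′ P) (suc k) + countBelow P (suc k)
                    ≡ suc (countBelow (not ∘′ P) k + countBelow P k))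
               (toℕ-fromℕ< m<n) (step-at (fromℕ< m<n)))
        (cong suc (countBelow-complement P m (<⇒≤ m<n)))
  where
  split : ∀ b x y → (x + indicator (not b)) + (y + indicator b) ≡ suc (x + y)
  split true x y rewrite +-identityʳ x | +-comm y 1 = +-suc x y
  split false x y rewrite +-identityʳ y | +-comm x 1 = refl
  step-at : ∀ d → countBelow (not ∘′ P) (suc (toℕ d)) + countBelow P (suc (toℕ d))
                ≡ suc (countBelow (not ∘′ P) (toℕ d) + countBelow P (toℕ d))
  step-at d = trans (cong₂ _+_ (countBelow-at (not ∘′ P) d) (countBelow-at P d))
                    (split (P d) (countBelow (not ∘′ P) (toℕ d)) (countBelow P (toℕ d)))

-- The root order and the reverse operator

coef-support : ∀ {n} (a b k : Fin n) → (1 ≤ᵇ coef a b k) ≡ true → toℕ a ≤ toℕ k × toℕ k ≤ toℕ b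
coef-support a b k e with a ≤F k in a≤k | k ≤F b in k≤b
... | true  | true  = ≤ᵇ-true⁻ a≤k , ≤ᵇ-true⁻ k≤b
... | true  | false = case e of λ ()
... | false | _     = case e of λ ()

coef-inside : ∀ {n} (a b k : Fin n) → toℕ a ≤ toℕ k → toℕ k ≤ toℕ b → coef a b k ≡ 1
coef-inside a b k a≤k k≤b rewrite ≤ᵇ-true⁺ a≤k | ≤ᵇ-true⁺ k≤b = refl

prec-true⁻ : ∀ {n} (i j i′ j′ : Fin n) → toℕ i ≤ toℕ j → prec i j i′ j′ ≡ true →
  toℕ i′ ≤ toℕ i × toℕ j ≤ toℕ j′
prec-true⁻ i j i′ j′ i≤j e =
  proj₁ (coef-support i′ j′ i (dominated i (coef-inside i j i ≤-refl i≤j))) ,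
  proj₂ (coef-support i′ j′ j (dominated j (coef-inside i j j i≤j ≤-refl)))
  where
  dominated : ∀ k → coef i j k ≡ 1 → (1 ≤ᵇ coef i′ j′ k) ≡ true
  dominated k c≡1 = subst (λ x → (x ≤ᵇ coef i′ j′ k) ≡ true) c≡1 (allF-true⁻ _ e k)

prec-true⁺ : ∀ {n} (i j i′ j′ : Fin n) → toℕ i′ ≤ toℕ i → toℕ j ≤ toℕ j′ →
  prec i j i′ j′ ≡ true
prec-true⁺ i j i′ j′ i′≤i j≤j′ = allF-true⁺ _ dominated
  where
  dominated : ∀ k → (coef i j k ≤ᵇ coef i′ j′ k) ≡ true
  dominated k with i ≤F k in i≤k | k ≤F j in k≤j
  ... | false | _     = refl
  ... | true  | false = refl
  ... | true  | true
    rewrite coef-inside i′ j′ k (≤-trans i′≤i (≤ᵇ-true⁻ i≤k)) (≤-trans (≤ᵇ-true⁻ k≤j) j≤j′)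
    = refl

IsRootSet : ∀ {n} → RootSet n → Set
IsRootSet {n} Γ = ∀ (i j : Fin n) → Γ i j ≡ true → toℕ i ≤ toℕ j

RootWithin : ∀ {n} → RootSet n → ℕ → ℕ → Set
RootWithin {n} Γ x y = ∃[ a ] ∃[ b ] Γ a b ≡ true × x ≤ toℕ a × toℕ b ≤ y

RootWithin-mono : ∀ {n} (Γ : RootSet n) {x y x′ y′} → x′ ≤ x → y ≤ y′ →
  RootWithin Γ x y → RootWithin Γ x′ y′
RootWithin-mono Γ x′≤x y≤y′ (a , b , g , x≤a , b≤y) =
  a , b , g , ≤-trans x′≤x x≤a , ≤-trans b≤y y≤y′

RootWithin? : ∀ {n} (Γ : RootSet n) x y → Dec (RootWithin Γ x y)
RootWithin? Γ x y with anyF (λ a → anyF (λ b → Γ a b ∧ ((x ≤ᵇ toℕ a) ∧ (toℕ b ≤ᵇ y)))) in found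
... | true with anyF-true⁻ _ found
...   | a , found-b with anyF-true⁻ _ found-b
...     | b , e = yes (a , b , ∧-true⁻ˡ e , ≤ᵇ-true⁻ (∧-true⁻ˡ (∧-true⁻ʳ {Γ a b} e))
                        , ≤ᵇ-true⁻ (∧-true⁻ʳ {x ≤ᵇ toℕ a} (∧-true⁻ʳ {Γ a b} e)))
RootWithin? Γ x y | false = no λ (a , b , g , x≤a , b≤y) →
  case trans (sym found)
    (anyF-true⁺ _ a (anyF-true⁺ _ b (∧-true⁺ g (∧-true⁺ (≤ᵇ-true⁺ x≤a) (≤ᵇ-true⁺ b≤y))))) of λ ()

upset-true⁻ : ∀ {n} (Γ : RootSet n) i j → upset Γ i j ≡ true → RootWithin Γ (toℕ i) (toℕ j)
upset-true⁻ Γ i j e with anyF-true⁻ _ e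
... | a , e′ with anyF-true⁻ _ e′
...   | b , e″ with prec-true⁻ a b i j (≤ᵇ-true⁻ (∧-true⁻ˡ (∧-true⁻ʳ {Γ a b} e″)))
                                     (∧-true⁻ʳ {isRoot a b} (∧-true⁻ʳ {Γ a b} e″))
...     | i≤a , b≤j = a , b , ∧-true⁻ˡ e″ , i≤a , b≤j

upset-true⁺ : ∀ {n} (Γ : RootSet n) → IsRootSet Γ → ∀ i j → RootWithin Γ (toℕ i) (toℕ j) →
  upset Γ i j ≡ true
upset-true⁺ Γ R i j (a , b , g , i≤a , b≤j) =
  anyF-true⁺ _ a (anyF-true⁺ _ b
    (∧-true⁺ g (∧-true⁺ (≤ᵇ-true⁺ (R a b g)) (prec-true⁺ a b i j i≤a b≤j))))

complUp-true⁻ : ∀ {n} (Γ : RootSet n) → IsRootSet Γ → ∀ i j → complUp Γ i j ≡ true →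
  toℕ i ≤ toℕ j × ¬ RootWithin Γ (toℕ i) (toℕ j)
complUp-true⁻ Γ R i j e =
  ≤ᵇ-true⁻ (∧-true⁻ˡ e) , λ w → not-true⁻ (∧-true⁻ʳ {isRoot i j} e) (upset-true⁺ Γ R i j w)

complUp-true⁺ : ∀ {n} (Γ : RootSet n) i j → toℕ i ≤ toℕ j → ¬ RootWithin Γ (toℕ i) (toℕ j) →
  complUp Γ i j ≡ true
complUp-true⁺ Γ i j i≤j free = ∧-true⁺ (≤ᵇ-true⁺ i≤j) (not-true⁺ (free ∘′ upset-true⁻ Γ i j))

maxElems-true⁻ : ∀ {n} (S : RootSet n) (c d a b : Fin n) → maxElems S c d ≡ true →
  S a b ≡ true → prec c d a b ≡ true → toℕ a ≡ toℕ c × toℕ b ≡ toℕ d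
maxElems-true⁻ S c d a b e s p with ∨-true⁻ (allF-true⁻ _ (allF-true⁻ _ (∧-true⁻ʳ {S c d} e) a) b)
... | inj₁ not-above = ⊥-elim (not-true⁻ not-above (∧-true⁺ s p))
... | inj₂ equal = ≡ᵇ-true⁻ (∧-true⁻ˡ equal) , ≡ᵇ-true⁻ (∧-true⁻ʳ {a ==F c} equal)

record MaximalGap {n} (Γ : RootSet n) (c d : Fin n) : Set where
  constructor maximalGap
  field
    ordered  : toℕ c ≤ toℕ d
    free     : ¬ RootWithin Γ (toℕ c) (toℕ d)
    blockedˡ : toℕ c ≡ 0 ⊎ RootWithin Γ (pred (toℕ c)) (toℕ d)
    blockedʳ : suc (toℕ d) ≡ n ⊎ RootWithin Γ (toℕ c) (suc (toℕ d))

revOp-true⁻ : ∀ {n} (Γ : RootSet n) → IsRootSet Γ → ∀ c d → revOp Γ c d ≡ true → MaximalGap Γ c d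
revOp-true⁻ {n} Γ R c d e = maximalGap c≤d free (blockedˡ (toℕ c) refl) blockedʳ
  where
  c≤d = proj₁ (complUp-true⁻ Γ R c d (∧-true⁻ˡ e))
  free = proj₂ (complUp-true⁻ Γ R c d (∧-true⁻ˡ e))

  no-larger-gap : ∀ a b → toℕ a ≤ toℕ b → ¬ RootWithin Γ (toℕ a) (toℕ b) →
    toℕ a ≤ toℕ c → toℕ d ≤ toℕ b → toℕ a ≡ toℕ c × toℕ b ≡ toℕ d
  no-larger-gap a b a≤b free′ a≤c d≤b =
    maxElems-true⁻ (complUp Γ) c d a b e (complUp-true⁺ Γ a b a≤b free′) (prec-true⁺ c d a b a≤c d≤b)

  blockedˡ : ∀ k → toℕ c ≡ k → k ≡ 0 ⊎ RootWithin Γ (pred k) (toℕ d)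
  blockedˡ zero _ = inj₁ refl
  blockedˡ (suc k) c≡1+k with RootWithin? Γ k (toℕ d)
  ... | yes w = inj₂ w
  ... | no free′ = ⊥-elim (1+n≢n (trans (sym c≡1+k) (trans (sym a≡c) a≡k)))
    where
    k<n = ≤-trans (n≤1+n _) (subst (_< n) c≡1+k (toℕ<n c))
    a = fromℕ< k<n
    a≡k = toℕ-fromℕ< k<n
    k≤c = subst (k ≤_) (sym c≡1+k) (n≤1+n k)
    a≡c = proj₁ (no-larger-gap a d
      (subst (_≤ toℕ d) (sym a≡k) (≤-trans k≤c c≤d))
      (subst (λ x → ¬ RootWithin Γ x (toℕ d)) (sym a≡k) free′)
      (subst (_≤ toℕ c) (sym a≡k) k≤c) ≤-refl)

  blockedʳ : suc (toℕ d) ≡ n ⊎ RootWithin Γ (toℕ c) (suc (toℕ d))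
  blockedʳ with suc (toℕ d) ≟ n
  ... | yes at-end = inj₁ at-end
  ... | no not-end with RootWithin? Γ (toℕ c) (suc (toℕ d))
  ...   | yes w = inj₂ w
  ...   | no free′ = ⊥-elim (1+n≢n (trans (sym b≡1+d) b≡d))
    where
    1+d<n = ≤∧≢⇒< (toℕ<n d) not-end
    b = fromℕ< 1+d<n
    b≡1+d = toℕ-fromℕ< 1+d<n
    b≡d = proj₂ (no-larger-gap c b
      (subst (toℕ c ≤_) (sym b≡1+d) (≤-trans c≤d (n≤1+n _)))
      (subst (λ x → ¬ RootWithin Γ (toℕ c) x) (sym b≡1+d) free′)
      ≤-refl (subst (toℕ d ≤_) (sym b≡1+d) (n≤1+n _)))

revOp-true⁺ : ∀ {n} (Γ : RootSet n) → IsRootSet Γ → ∀ c d → MaximalGap Γ c d → revOp Γ c d ≡ true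
revOp-true⁺ {n} Γ R c d (maximalGap c≤d free blockedˡ blockedʳ) =
  ∧-true⁺ (complUp-true⁺ Γ c d c≤d free) (allF-true⁺ _ λ a → allF-true⁺ _ λ b → maximal a b)
  where
  maximal : ∀ a b → (not (complUp Γ a b ∧ prec c d a b) ∨ ((a ==F c) ∧ (b ==F d))) ≡ true
  maximal a b with complUp Γ a b ∧ prec c d a b in above
  ... | false = refl
  ... | true = ∧-true⁺ (≡ᵇ-true⁺ a≡c) (≡ᵇ-true⁺ b≡d)
    where
    free′ = proj₂ (complUp-true⁻ Γ R a b (∧-true⁻ˡ above))
    ⊆ = prec-true⁻ c d a b c≤d (∧-true⁻ʳ {complUp Γ a b} above)
    a≮c : ¬ toℕ a < toℕ c
    a≮c a<c = [ (λ c≡0 → n≮0 (subst (toℕ a <_) c≡0 a<c))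
              , (λ w → free′ (RootWithin-mono Γ (<⇒≤pred a<c) (proj₂ ⊆) w)) ] blockedˡ
    d≮b : ¬ toℕ d < toℕ b
    d≮b d<b = [ (λ 1+d≡n → <⇒≱ (toℕ<n b) (subst (_≤ toℕ b) 1+d≡n d<b))
              , (λ w → free′ (RootWithin-mono Γ (proj₁ ⊆) d<b w)) ] blockedʳ
    a≡c = ≤-antisym (proj₁ ⊆) (≮⇒≥ a≮c)
    b≡d = ≤-antisym (≮⇒≥ d≮b) (proj₂ ⊆)

revOp-antichain : ∀ {n} (Γ : RootSet n) → IsAntichain (revOp Γ)
revOp-antichain Γ = (λ i j e → ∧-true⁻ˡ (∧-true⁻ˡ e)) , λ i j i′ j′ e e′ p →
  let (i′≡i , j′≡j) = maxElems-true⁻ (complUp Γ) i j i′ j′ e (∧-true⁻ˡ e′) p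
  in toℕ-injective (sym i′≡i) , toℕ-injective (sym j′≡j)

-- Antichains and their index sequences

module _ {n} (Γ : RootSet n) where

  firstIdx-true⁻ : ∀ a → firstIdx Γ a ≡ true → ∃[ b ] Γ a b ≡ true
  firstIdx-true⁻ a = anyF-true⁻ _

  firstIdx-true⁺ : ∀ a b → Γ a b ≡ true → firstIdx Γ a ≡ true
  firstIdx-true⁺ a b = anyF-true⁺ _ b

  secondIdx-true⁻ : ∀ b → secondIdx Γ b ≡ true → ∃[ a ] Γ a b ≡ true
  secondIdx-true⁻ b = anyF-true⁻ _

  secondIdx-true⁺ : ∀ a b → Γ a b ≡ true → secondIdx Γ b ≡ true
  secondIdx-true⁺ a b = anyF-true⁺ (λ x → Γ x b) a

module Antichain {n} (Γ : RootSet n) (ac : IsAntichain Γ) where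

  I J : Fin n → Bool
  I = firstIdx Γ
  J = secondIdx Γ

  isRootSet : IsRootSet Γ
  isRootSet i j g = ≤ᵇ-true⁻ (proj₁ ac i j g)

  nested⇒equal : ∀ {a b a′ b′} → Γ a b ≡ true → Γ a′ b′ ≡ true →
    toℕ a′ ≤ toℕ a → toℕ b ≤ toℕ b′ → a ≡ a′ × b ≡ b′
  nested⇒equal {a} {b} {a′} {b′} g g′ a′≤a b≤b′ =
    proj₂ ac a b a′ b′ g g′ (prec-true⁺ a b a′ b′ a′≤a b≤b′)

  <-first⇒<-second : ∀ {a b a′ b′} → Γ a b ≡ true → Γ a′ b′ ≡ true →
    toℕ a < toℕ a′ → toℕ b < toℕ b′
  <-first⇒<-second g g′ a<a′ = ≰⇒> λ b′≤b →
    <⇒≢ a<a′ (cong toℕ (sym (proj₁ (nested⇒equal g′ g (<⇒≤ a<a′) b′≤b))))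

  <-second⇒<-first : ∀ {a b a′ b′} → Γ a b ≡ true → Γ a′ b′ ≡ true →
    toℕ b < toℕ b′ → toℕ a < toℕ a′
  <-second⇒<-first g g′ b<b′ = ≰⇒> λ a′≤a →
    <⇒≢ b<b′ (cong toℕ (proj₂ (nested⇒equal g g′ a′≤a (<⇒≤ b<b′))))

  distinct⇒< : ∀ {a b} → Γ a b ≡ true → a ≢ b → toℕ a < toℕ b
  distinct⇒< {a} {b} g a≢b = ≤∧≢⇒< (isRootSet a b g) (a≢b ∘′ toℕ-injective)

  diagonal-before-second : ∀ {a c c′} → Γ a c ≡ true → toℕ a < toℕ c → suc (toℕ c′) ≡ toℕ c →
    Γ c′ c′ ≢ true
  diagonal-before-second g a<c 1+c′≡c Γc′c′ = 1+n≢n (trans 1+c′≡c (cong toℕ (sym c′≡c)))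
    where
    c′≡c = proj₂ (nested⇒equal Γc′c′ g
      (≤-pred (subst (_ <_) (sym 1+c′≡c) a<c)) (subst (_ ≤_) 1+c′≡c (n≤1+n _)))

  diagonal-after-first : ∀ {d b d′} → Γ d b ≡ true → toℕ d < toℕ b → toℕ d′ ≡ suc (toℕ d) →
    Γ d′ d′ ≢ true
  diagonal-after-first g d<b d′≡1+d Γd′d′ = 1+n≢n (trans (sym d′≡1+d) (cong toℕ d′≡d))
    where
    d′≡d = proj₁ (nested⇒equal Γd′d′ g
      (subst (_ ≤_) (sym d′≡1+d) (n≤1+n _)) (subst (_≤ _) (sym d′≡1+d) d<b))

  -- Induction on the sum of the ranks: an element of I below a has its partner below b, and conversely.
  private
    ranks-agree-below : ∀ k a b → Γ a b ≡ true → countBelow I (toℕ a) + countBelow J (toℕ b) ≤ k →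
      countBelow I (toℕ a) ≡ countBelow J (toℕ b)
    ranks-agree-below zero a b g ≤0 =
      trans (m+n≡0⇒m≡0 _ (n≤0⇒n≡0 ≤0)) (sym (m+n≡0⇒n≡0 _ (n≤0⇒n≡0 ≤0)))
    ranks-agree-below (suc k) a b g ≤1+k = ≤-antisym (rank-I≤rank-J _ refl) (rank-J≤rank-I _ refl)
      where
      shrink : ∀ {x y x′ y′} → x′ < x → y′ < y → x + y ≤ suc k → x′ + y′ ≤ k
      shrink x′<x y′<y s = ≤-pred (≤-trans (+-mono-<-≤ x′<x (<⇒≤ y′<y)) s)
      rank-I≤rank-J : ∀ r → countBelow I (toℕ a) ≡ r → r ≤ countBelow J (toℕ b)
      rank-I≤rank-J zero _ = z≤n
      rank-I≤rank-J (suc r) e with countBelow-attained I (toℕ a) r (subst (r <_) (sym e) (n<1+n r))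
      ... | a′ , Ia′ , a′<a , rank-a′ with firstIdx-true⁻ Γ a′ Ia′
      ...   | b′ , g′ = subst (_≤ countBelow J (toℕ b)) (cong suc (trans (sym ih) rank-a′))
                          (countBelow-strict J b′ (secondIdx-true⁺ Γ a′ b′ g′) b′<b)
        where
        b′<b = <-first⇒<-second g′ g a′<a
        ih = ranks-agree-below k a′ b′ g′ (shrink (countBelow-strict I a′ Ia′ a′<a)
               (countBelow-strict J b′ (secondIdx-true⁺ Γ a′ b′ g′) b′<b) ≤1+k)
      rank-J≤rank-I : ∀ r → countBelow J (toℕ b) ≡ r → r ≤ countBelow I (toℕ a)
      rank-J≤rank-I zero _ = z≤n
      rank-J≤rank-I (suc r) e with countBelow-attained J (toℕ b) r (subst (r <_) (sym e) (n<1+n r))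
      ... | b′ , Jb′ , b′<b , rank-b′ with secondIdx-true⁻ Γ b′ Jb′
      ...   | a′ , g′ = subst (_≤ countBelow I (toℕ a)) (cong suc (trans ih rank-b′))
                          (countBelow-strict I a′ (firstIdx-true⁺ Γ a′ b′ g′) a′<a)
        where
        a′<a = <-second⇒<-first g′ g b′<b
        ih = ranks-agree-below k a′ b′ g′ (shrink (countBelow-strict I a′ (firstIdx-true⁺ Γ a′ b′ g′) a′<a)
               (countBelow-strict J b′ Jb′ b′<b) ≤1+k)

  ranks-agree : ∀ a b → Γ a b ≡ true → countBelow I (toℕ a) ≡ countBelow J (toℕ b)
  ranks-agree a b g = ranks-agree-below _ a b g ≤-refl

  paired-by-rank : ∀ a b → I a ≡ true → J b ≡ true →
    countBelow I (toℕ a) ≡ countBelow J (toℕ b) → Γ a b ≡ true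
  paired-by-rank a b Ia Jb e with firstIdx-true⁻ Γ a Ia
  ... | b′ , g′ = subst (λ x → Γ a x ≡ true)
     (countBelow-injective J b′ b (secondIdx-true⁺ Γ a b′ g′) Jb (trans (sym (ranks-agree a b′ g′)) e)) g′

  countBelow-J≤I : ∀ m → countBelow J m ≤ countBelow I m
  countBelow-J≤I m = ≮⇒≥ λ lt → contra (countBelow-attained J m (countBelow I m) lt)
    where
    contra : ¬ (∃[ b ] J b ≡ true × toℕ b < m × countBelow J (toℕ b) ≡ countBelow I m)
    contra (b , Jb , b<m , rank-b) with secondIdx-true⁻ Γ b Jb
    ... | a , g = <⇒≢ (countBelow-strict I a (firstIdx-true⁺ Γ a b g) (≤-<-trans (isRootSet a b g) b<m))
                      (trans (ranks-agree a b g) rank-b)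

  countBelow-I≡J : countBelow I n ≡ countBelow J n
  countBelow-I≡J =
    ≤-antisym (≮⇒≥ λ lt → contra (countBelow-attained I n (countBelow J n) lt)) (countBelow-J≤I n)
    where
    contra : ¬ (∃[ a ] I a ≡ true × toℕ a < n × countBelow I (toℕ a) ≡ countBelow J n)
    contra (a , Ia , _ , rank-a) with firstIdx-true⁻ Γ a Ia
    ... | b , g = <⇒≢ (countBelow-strict J b (secondIdx-true⁺ Γ a b g) (toℕ<n b))
                      (trans (sym (ranks-agree a b g)) rank-a)

antichain-ext : ∀ {n} {Γ Δ : RootSet n} → IsAntichain Γ → IsAntichain Δ →
  (∀ c → firstIdx Γ c ≡ firstIdx Δ c) → (∀ c → secondIdx Γ c ≡ secondIdx Δ c) → Γ ≐ Δ
antichain-ext acΓ acΔ I≗ J≗ a b =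
  bool-ext (transfer acΓ acΔ I≗ J≗) (transfer acΔ acΓ (λ c → sym (I≗ c)) (λ c → sym (J≗ c)))
  where
  transfer : ∀ {S T} → IsAntichain S → IsAntichain T →
    (∀ c → firstIdx S c ≡ firstIdx T c) → (∀ c → secondIdx S c ≡ secondIdx T c) →
    S a b ≡ true → T a b ≡ true
  transfer {S} {T} acS acT I≗ J≗ g = Antichain.paired-by-rank T acT a b
    (trans (sym (I≗ a)) (firstIdx-true⁺ S a b g)) (trans (sym (J≗ b)) (secondIdx-true⁺ S a b g))
    (trans (sym (countBelow-cong I≗ (toℕ a)))
      (trans (Antichain.ranks-agree S acS a b g) (countBelow-cong J≗ (toℕ b))))

-- Duality

RankMatched : ∀ {n} (P Q : Fin n → Bool) → Fin n → Fin n → Set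
RankMatched P Q a b = P a ≡ true × Q b ≡ true × countBelow P (toℕ a) ≡ countBelow Q (toℕ b)

dual-true⁻ : ∀ {n} (Γ : RootSet n) a b → dual Γ a b ≡ true →
  RankMatched (not ∘′ secondIdx Γ) (not ∘′ firstIdx Γ) a b
dual-true⁻ Γ a b e =
  ∧-true⁻ˡ e , ∧-true⁻ˡ (∧-true⁻ʳ {not (secondIdx Γ a)} e) ,
  ≡ᵇ-true⁻ (∧-true⁻ʳ {not (firstIdx Γ b)} (∧-true⁻ʳ {not (secondIdx Γ a)} e))

dual-true⁺ : ∀ {n} (Γ : RootSet n) a b →
  RankMatched (not ∘′ secondIdx Γ) (not ∘′ firstIdx Γ) a b → dual Γ a b ≡ true
dual-true⁺ Γ a b (Jca , Icb , e) = ∧-true⁺ Jca (∧-true⁺ Icb (≡ᵇ-true⁺ e))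

module RankMatching {n} (P Q : Fin n → Bool)
  (ballot : ∀ m → m ≤ n → countBelow Q m ≤ countBelow P m)
  (balanced : countBelow P n ≡ countBelow Q n) where

  matched-ordered : ∀ {a b} → RankMatched P Q a b → toℕ a ≤ toℕ b
  matched-ordered {a} {b} (Pa , Qb , e) = ≮⇒≥ λ b<a → <-irrefl refl (begin-strict
      countBelow P (toℕ a)       ≡⟨ e ⟩
      countBelow Q (toℕ b)       <⟨ countBelow-strict Q b Qb (n<1+n _) ⟩
      countBelow Q (suc (toℕ b)) ≤⟨ ballot _ (toℕ<n b) ⟩
      countBelow P (suc (toℕ b)) ≤⟨ countBelow-mono P b<a ⟩
      countBelow P (toℕ a)       ∎)
    where open ≤-Reasoning

  matched-nested⇒equal : ∀ {a b a′ b′} → RankMatched P Q a b → RankMatched P Q a′ b′ →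
    toℕ a′ ≤ toℕ a → toℕ b ≤ toℕ b′ → a ≡ a′ × b ≡ b′
  matched-nested⇒equal {a} {b} {a′} {b′} (Pa , Qb , e) (Pa′ , Qb′ , e′) a′≤a b≤b′ =
    countBelow-injective P a a′ Pa Pa′
      (≤-antisym (subst₂ _≤_ (sym e) (sym e′) rank-b≤rank-b′) rank-a′≤rank-a) ,
    countBelow-injective Q b b′ Qb Qb′ (≤-antisym rank-b≤rank-b′ (subst₂ _≤_ e′ e rank-a′≤rank-a))
    where
    rank-a′≤rank-a = countBelow-mono P a′≤a
    rank-b≤rank-b′ = countBelow-mono Q b≤b′

  match-first : ∀ a → P a ≡ true → ∃[ b ] RankMatched P Q a b
  match-first a Pa with countBelow-attained Q n (countBelow P (toℕ a))
                          (subst (countBelow P (toℕ a) <_) balanced (countBelow-strict P a Pa (toℕ<n a)))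
  ... | b , Qb , _ , e = b , Pa , Qb , sym e

  match-second : ∀ b → Q b ≡ true → ∃[ a ] RankMatched P Q a b
  match-second b Qb with countBelow-attained P n (countBelow Q (toℕ b))
                          (subst (countBelow Q (toℕ b) <_) (sym balanced) (countBelow-strict Q b Qb (toℕ<n b)))
  ... | a , Pa , _ , e = a , Pa , Qb , e

Covers : ∀ {n} → RootSet n → Fin n → Set
Covers {n} Γ c = ∃[ a ] ∃[ b ] Γ a b ≡ true × toℕ a ≤ toℕ c × toℕ c ≤ toℕ b

module Dual {n} (Γ : RootSet n) (ac : IsAntichain Γ) where
  open Antichain Γ ac

  Ic Jc : Fin n → Bool
  Ic = not ∘′ I
  Jc = not ∘′ J

  complements-sum : ∀ m → m ≤ n → countBelow Jc m + countBelow J m ≡ countBelow Ic m + countBelow I m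
  complements-sum m m≤n = trans (countBelow-complement J m m≤n) (sym (countBelow-complement I m m≤n))

  countBelow-Ic≤Jc : ∀ m → m ≤ n → countBelow Ic m ≤ countBelow Jc m
  countBelow-Ic≤Jc m m≤n = +-cancelʳ-≤ (countBelow J m) _ _
    (≤-trans (+-monoʳ-≤ (countBelow Ic m) (countBelow-J≤I m)) (≤-reflexive (sym (complements-sum m m≤n))))

  countBelow-Jc≡Ic : countBelow Jc n ≡ countBelow Ic n
  countBelow-Jc≡Ic = +-cancelʳ-≡ (countBelow J n) _ _
    (trans (complements-sum n ≤-refl) (cong (countBelow Ic n +_) countBelow-I≡J))

  countBelow-Jc≡Ic⇒J≡I : ∀ c → countBelow Jc (toℕ c) ≡ countBelow Ic (toℕ c) →
    countBelow J (toℕ c) ≡ countBelow I (toℕ c)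
  countBelow-Jc≡Ic⇒J≡I c e = +-cancelˡ-≡ (countBelow Jc (toℕ c)) _ _
    (trans (complements-sum (toℕ c) (<⇒≤ (toℕ<n c))) (cong (_+ countBelow I (toℕ c)) (sym e)))

  countBelow-J≡I⇒Jc≡Ic : ∀ c → countBelow J (toℕ c) ≡ countBelow I (toℕ c) →
    countBelow Jc (toℕ c) ≡ countBelow Ic (toℕ c)
  countBelow-J≡I⇒Jc≡Ic c e = +-cancelʳ-≡ (countBelow J (toℕ c)) _ _
    (trans (complements-sum (toℕ c) (<⇒≤ (toℕ<n c))) (cong (countBelow Ic (toℕ c) +_) (sym e)))

  open RankMatching Jc Ic countBelow-Ic≤Jc countBelow-Jc≡Ic

  dual-antichain : IsAntichain (dual Γ)
  dual-antichain = (λ a b e → ≤ᵇ-true⁺ (matched-ordered (dual-true⁻ Γ a b e))) , nested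
    where
    nested : ∀ a b a′ b′ → dual Γ a b ≡ true → dual Γ a′ b′ ≡ true →
      prec a b a′ b′ ≡ true → a ≡ a′ × b ≡ b′
    nested a b a′ b′ e e′ p =
      let m = dual-true⁻ Γ a b e
          (a′≤a , b≤b′) = prec-true⁻ a b a′ b′ (matched-ordered m) p
      in matched-nested⇒equal m (dual-true⁻ Γ a′ b′ e′) a′≤a b≤b′

  firstIdx-dual : ∀ c → firstIdx (dual Γ) c ≡ Jc c
  firstIdx-dual c = bool-ext
    (λ e → let (b , g) = firstIdx-true⁻ (dual Γ) c e in proj₁ (dual-true⁻ Γ c b g))
    (λ Jcc → let (b , m) = match-first c Jcc in firstIdx-true⁺ (dual Γ) c b (dual-true⁺ Γ c b m))

  secondIdx-dual : ∀ c → secondIdx (dual Γ) c ≡ Ic c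
  secondIdx-dual c = bool-ext
    (λ e → let (a , g) = secondIdx-true⁻ (dual Γ) c e in proj₁ (proj₂ (dual-true⁻ Γ a c g)))
    (λ Icc → let (a , m) = match-second c Icc in secondIdx-true⁺ (dual Γ) a c (dual-true⁺ Γ a c m))

  dual-diagonal⇒uncovered : ∀ c → dual Γ c c ≡ true → ¬ Covers Γ c
  dual-diagonal⇒uncovered c e (a , b , g , a≤c , c≤b) = <-irrefl refl (begin-strict
      countBelow J (toℕ c) ≤⟨ countBelow-mono J c≤b ⟩
      countBelow J (toℕ b) ≡⟨ ranks-agree a b g ⟨
      countBelow I (toℕ a) <⟨ countBelow-strict I a (firstIdx-true⁺ Γ a b g) a<c ⟩
      countBelow I (toℕ c) ≡⟨ countBelow-Jc≡Ic⇒J≡I c ranks ⟨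
      countBelow J (toℕ c) ∎)
    where
    open ≤-Reasoning
    Icc = proj₁ (proj₂ (dual-true⁻ Γ c c e))
    ranks = proj₂ (proj₂ (dual-true⁻ Γ c c e))
    a<c = ≤∧≢⇒< a≤c λ a≡c →
      not-true⁻ Icc (subst (λ x → I x ≡ true) (toℕ-injective a≡c) (firstIdx-true⁺ Γ a b g))

  uncovered⇒dual-diagonal : ∀ c → ¬ Covers Γ c → dual Γ c c ≡ true
  uncovered⇒dual-diagonal c uncovered = dual-true⁺ Γ c c (Jcc , Icc , countBelow-J≡I⇒Jc≡Ic c ranks)
    where
    Jcc : Jc c ≡ true
    Jcc = not-true⁺ λ c∈J →
      let (a , g) = secondIdx-true⁻ Γ c c∈J in uncovered (a , c , g , isRootSet a c g , ≤-refl)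
    Icc : Ic c ≡ true
    Icc = not-true⁺ λ c∈I →
      let (b , g) = firstIdx-true⁻ Γ c c∈I in uncovered (c , b , g , ≤-refl , isRootSet c b g)
    -- Otherwise the root whose first index has rank countBelow J c, which lies below c, would cover c.
    ranks : countBelow J (toℕ c) ≡ countBelow I (toℕ c)
    ranks = ≤-antisym (countBelow-J≤I (toℕ c))
      (≮⇒≥ λ lt → contra (countBelow-attained I (toℕ c) (countBelow J (toℕ c)) lt))
      where
      contra : ¬ (∃[ a ] I a ≡ true × toℕ a < toℕ c × countBelow I (toℕ a) ≡ countBelow J (toℕ c))
      contra (a , Ia , a<c , rank-a) with firstIdx-true⁻ Γ a Ia
      ... | b , g = uncovered (a , b , g , <⇒≤ a<c , ≮⇒≥ λ b<c →
              <⇒≢ (countBelow-strict J b (secondIdx-true⁺ Γ a b g) b<c)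
                  (trans (sym (ranks-agree a b g)) rank-a))

-- Index sequences of the reverse operator

extendRight : ∀ n (B : ℕ → Set) → (∀ x → Dec (B x)) → ∀ x → x < n → ¬ B x →
  ∃[ y ] x ≤ y × y < n × ¬ B y × (suc y ≡ n ⊎ B (suc y))
extendRight n B B? x x<n ¬Bx = go (n ∸ suc x) x (m+[n∸m]≡n x<n) ¬Bx
  where
  go : ∀ k x → suc x + k ≡ n → ¬ B x → ∃[ y ] x ≤ y × y < n × ¬ B y × (suc y ≡ n ⊎ B (suc y))
  go zero x e ¬Bx =
    x , ≤-refl , subst (x <_) e (m≤m+n (suc x) 0) , ¬Bx , inj₁ (trans (sym (+-identityʳ _)) e)
  go (suc k) x e ¬Bx with B? (suc x)
  ... | yes B1+x = x , ≤-refl , subst (x <_) e (m≤m+n (suc x) (suc k)) , ¬Bx , inj₂ B1+x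
  ... | no ¬B1+x with go k (suc x) (trans (sym (+-suc (suc x) k)) e) ¬B1+x
  ...   | y , 1+x≤y , rest = y , ≤-trans (n≤1+n x) 1+x≤y , rest

extendLeft : ∀ (B : ℕ → Set) → (∀ x → Dec (B x)) → ∀ x → ¬ B x →
  ∃[ y ] y ≤ x × ¬ B y × (y ≡ 0 ⊎ B (pred y))
extendLeft B B? zero ¬B0 = 0 , ≤-refl , ¬B0 , inj₁ refl
extendLeft B B? (suc x) ¬B1+x with B? x
... | yes Bx = suc x , ≤-refl , ¬B1+x , inj₂ Bx
... | no ¬Bx with extendLeft B B? x ¬Bx
...   | y , y≤x , rest = y , ≤-trans y≤x (n≤1+n x) , rest

m≤suc[pred[m]] : ∀ m → m ≤ suc (pred m)
m≤suc[pred[m]] zero = z≤n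
m≤suc[pred[m]] (suc m) = ≤-refl

FirstOrPredIn : ∀ {n} → (Fin n → Bool) → Fin n → Set
FirstOrPredIn {n} P c = toℕ c ≡ 0 ⊎ ∃[ c′ ] suc (toℕ c′) ≡ toℕ c × P c′ ≡ true

LastOrSuccIn : ∀ {n} → (Fin n → Bool) → Fin n → Set
LastOrSuccIn {n} P d = suc (toℕ d) ≡ n ⊎ ∃[ d′ ] toℕ d′ ≡ suc (toℕ d) × P d′ ≡ true

module Reverse {n} (Γ : RootSet n) (ac : IsAntichain Γ) where
  open Antichain Γ ac

  off-diagonal⇒point-free : ∀ c → Γ c c ≢ true → ¬ RootWithin Γ (toℕ c) (toℕ c)
  off-diagonal⇒point-free c Γcc≢true (a , b , g , c≤a , b≤c) =
    Γcc≢true (subst₂ (λ x y → Γ x y ≡ true) a≡c b≡c g)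
    where
    a≡c = toℕ-injective (≤-antisym (≤-trans (isRootSet a b g) b≤c) c≤a)
    b≡c = toℕ-injective (≤-antisym b≤c (≤-trans c≤a (isRootSet a b g)))

  gap-rightwards : ∀ c → Γ c c ≢ true →
    ∃[ y ] toℕ c ≤ y × y < n × ¬ RootWithin Γ (toℕ c) y × (suc y ≡ n ⊎ RootWithin Γ (toℕ c) (suc y))
  gap-rightwards c Γcc≢true =
    extendRight n (RootWithin Γ (toℕ c)) (RootWithin? Γ (toℕ c)) (toℕ c) (toℕ<n c)
      (off-diagonal⇒point-free c Γcc≢true)

  gap-leftwards : ∀ x (d : Fin n) → ¬ RootWithin Γ x (toℕ d) →
    ∃[ y ] y ≤ x × ¬ RootWithin Γ y (toℕ d) × (y ≡ 0 ⊎ RootWithin Γ (pred y) (toℕ d))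
  gap-leftwards x d = extendLeft (λ y → RootWithin Γ y (toℕ d)) (λ y → RootWithin? Γ y (toℕ d)) x

  firstIdx-revOp-true⁻ : ∀ c → firstIdx (revOp Γ) c ≡ true → FirstOrPredIn I c × Γ c c ≢ true
  firstIdx-revOp-true⁻ c e with firstIdx-true⁻ (revOp Γ) c e
  ... | d , g with revOp-true⁻ Γ isRootSet c d g
  ...   | maximalGap c≤d free blockedˡ _ = left blockedˡ , λ Γcc → free (c , c , Γcc , ≤-refl , c≤d)
    where
    left : toℕ c ≡ 0 ⊎ RootWithin Γ (pred (toℕ c)) (toℕ d) → FirstOrPredIn I c
    left (inj₁ c≡0) = inj₁ c≡0
    left (inj₂ (a , b , g′ , c-1≤a , b≤d)) =
      inj₂ (a , ≤-antisym a<c (≤-trans (m≤suc[pred[m]] (toℕ c)) (s≤s c-1≤a)) , firstIdx-true⁺ Γ a b g′)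
      where
      a<c : toℕ a < toℕ c
      a<c = ≰⇒> λ c≤a → free (a , b , g′ , c≤a , b≤d)

  firstIdx-revOp-true⁺ : ∀ c → FirstOrPredIn I c → Γ c c ≢ true → firstIdx (revOp Γ) c ≡ true
  firstIdx-revOp-true⁺ c start Γcc≢true with gap-rightwards c Γcc≢true
  ... | y , c≤y , y<n , free , blockedʳ =
    firstIdx-true⁺ (revOp Γ) c d (revOp-true⁺ Γ isRootSet c d
      (maximalGap (subst (toℕ c ≤_) (sym d≡y) c≤y)
                  (subst (λ z → ¬ RootWithin Γ (toℕ c) z) (sym d≡y) free)
                  (blockedˡ start)
                  (subst (λ z → suc z ≡ n ⊎ RootWithin Γ (toℕ c) (suc z)) (sym d≡y) blockedʳ)))
    where
    d = fromℕ< y<n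
    d≡y = toℕ-fromℕ< y<n
    partner-≤y : ∀ {a b} → Γ a b ≡ true → suc (toℕ a) ≡ toℕ c → toℕ b ≤ y
    partner-≤y {b = b} g 1+a≡c = ≤-pred ([ below-end , below-blocker ] blockedʳ)
      where
      below-end : suc y ≡ n → toℕ b < suc y
      below-end 1+y≡n = subst (toℕ b <_) (sym 1+y≡n) (toℕ<n b)
      below-blocker : RootWithin Γ (toℕ c) (suc y) → toℕ b < suc y
      below-blocker (a₁ , b₁ , g₁ , c≤a₁ , b₁≤1+y) =
        ≤-trans (<-first⇒<-second g g₁ (subst (_≤ toℕ a₁) (sym 1+a≡c) c≤a₁)) b₁≤1+y
    blockedˡ : FirstOrPredIn I c → toℕ c ≡ 0 ⊎ RootWithin Γ (pred (toℕ c)) (toℕ d)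
    blockedˡ (inj₁ c≡0) = inj₁ c≡0
    blockedˡ (inj₂ (c′ , 1+c′≡c , Ic′)) with firstIdx-true⁻ Γ c′ Ic′
    ... | b , g = inj₂ (c′ , b , g , ≤-reflexive (cong pred (sym 1+c′≡c)) ,
                        subst (toℕ b ≤_) (sym d≡y) (partner-≤y g 1+c′≡c))

  secondIdx-revOp-true⁻ : ∀ d → secondIdx (revOp Γ) d ≡ true → LastOrSuccIn J d × Γ d d ≢ true
  secondIdx-revOp-true⁻ d e with secondIdx-true⁻ (revOp Γ) d e
  ... | c , g with revOp-true⁻ Γ isRootSet c d g
  ...   | maximalGap c≤d free _ blockedʳ = right blockedʳ , λ Γdd → free (d , d , Γdd , c≤d , ≤-refl)
    where
    right : suc (toℕ d) ≡ n ⊎ RootWithin Γ (toℕ c) (suc (toℕ d)) → LastOrSuccIn J d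
    right (inj₁ 1+d≡n) = inj₁ 1+d≡n
    right (inj₂ (a , b , g′ , c≤a , b≤1+d)) = inj₂ (b , ≤-antisym b≤1+d d<b , secondIdx-true⁺ Γ a b g′)
      where
      d<b : toℕ d < toℕ b
      d<b = ≰⇒> λ b≤d → free (a , b , g′ , c≤a , b≤d)

  secondIdx-revOp-true⁺ : ∀ d → LastOrSuccIn J d → Γ d d ≢ true → secondIdx (revOp Γ) d ≡ true
  secondIdx-revOp-true⁺ d end Γdd≢true with gap-leftwards (toℕ d) d (off-diagonal⇒point-free d Γdd≢true)
  ... | y , y≤d , free , blockedˡ =
    secondIdx-true⁺ (revOp Γ) c d (revOp-true⁺ Γ isRootSet c d
      (maximalGap (subst (_≤ toℕ d) (sym c≡y) y≤d)
                  (subst (λ z → ¬ RootWithin Γ z (toℕ d)) (sym c≡y) free)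
                  (subst (λ z → z ≡ 0 ⊎ RootWithin Γ (pred z) (toℕ d)) (sym c≡y) blockedˡ)
                  (blockedʳ end)))
    where
    y<n = ≤-<-trans y≤d (toℕ<n d)
    c = fromℕ< y<n
    c≡y = toℕ-fromℕ< y<n
    y≤partner : ∀ {a b} → Γ a b ≡ true → toℕ b ≡ suc (toℕ d) → y ≤ toℕ a
    y≤partner {a} g b≡1+d = [ after-start , after-blocker ] blockedˡ
      where
      after-start : y ≡ 0 → y ≤ toℕ a
      after-start refl = z≤n
      after-blocker : RootWithin Γ (pred y) (toℕ d) → y ≤ toℕ a
      after-blocker (a₁ , b₁ , g₁ , y-1≤a₁ , b₁≤d) = ≤-trans (m≤suc[pred[m]] y)
        (≤-trans (s≤s y-1≤a₁) (<-second⇒<-first g₁ g (subst (toℕ b₁ <_) (sym b≡1+d) (s≤s b₁≤d))))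
    blockedʳ : LastOrSuccIn J d → suc (toℕ d) ≡ n ⊎ RootWithin Γ (toℕ c) (suc (toℕ d))
    blockedʳ (inj₁ 1+d≡n) = inj₁ 1+d≡n
    blockedʳ (inj₂ (d′ , d′≡1+d , Jd′)) with secondIdx-true⁻ Γ d′ Jd′
    ... | a , g = inj₂ (a , d′ , g , subst (_≤ toℕ a) (sym c≡y) (y≤partner g d′≡1+d) , ≤-reflexive d′≡1+d)

  revOp-covers⇒off-diagonal : ∀ c → Covers (revOp Γ) c → Γ c c ≢ true
  revOp-covers⇒off-diagonal c (a , b , g , a≤c , c≤b) Γcc =
    MaximalGap.free (revOp-true⁻ Γ isRootSet a b g) (c , c , Γcc , a≤c , c≤b)

  off-diagonal⇒revOp-covers : ∀ c → Γ c c ≢ true → Covers (revOp Γ) c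
  off-diagonal⇒revOp-covers c Γcc≢true with gap-leftwards (toℕ c) c (off-diagonal⇒point-free c Γcc≢true)
  ... | y , y≤c , free-y , blockedˡ-y
    with extendRight n (RootWithin Γ y) (RootWithin? Γ y) (toℕ c) (toℕ<n c) free-y
  ...   | z , c≤z , z<n , free , blockedʳ =
    a , b , revOp-true⁺ Γ isRootSet a b
      (maximalGap (subst₂ _≤_ (sym a≡y) (sym b≡z) (≤-trans y≤c c≤z))
                  (subst₂ (λ u v → ¬ RootWithin Γ u v) (sym a≡y) (sym b≡z) free)
                  (subst₂ (λ u v → u ≡ 0 ⊎ RootWithin Γ (pred u) v) (sym a≡y) (sym b≡z) blockedˡ)
                  (subst₂ (λ u v → suc v ≡ n ⊎ RootWithin Γ u (suc v)) (sym a≡y) (sym b≡z) blockedʳ)) ,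
    subst (_≤ toℕ c) (sym a≡y) y≤c , subst (toℕ c ≤_) (sym b≡z) c≤z
    where
    y<n = ≤-<-trans y≤c (toℕ<n c)
    a = fromℕ< y<n
    a≡y = toℕ-fromℕ< y<n
    b = fromℕ< z<n
    b≡z = toℕ-fromℕ< z<n
    blockedˡ : y ≡ 0 ⊎ RootWithin Γ (pred y) z
    blockedˡ = [ inj₁ , (λ w → inj₂ (RootWithin-mono Γ ≤-refl c≤z w)) ] blockedˡ-y

zero-or-suc : ∀ {n} (c : Fin n) → toℕ c ≡ 0 ⊎ ∃[ c′ ] suc (toℕ c′) ≡ toℕ c
zero-or-suc {n} c with toℕ c in e
... | zero = inj₁ refl
... | suc k = inj₂ (fromℕ< k<n , cong suc (toℕ-fromℕ< k<n))
  where
  k<n : k < n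
  k<n = ≤-trans (n≤1+n _) (subst (_< n) e (toℕ<n c))

last-or-suc : ∀ {n} (d : Fin n) → suc (toℕ d) ≡ n ⊎ ∃[ d′ ] toℕ d′ ≡ suc (toℕ d)
last-or-suc {n} d with suc (toℕ d) ≟ n
... | yes 1+d≡n = inj₁ 1+d≡n
... | no 1+d≢n = inj₂ (fromℕ< 1+d<n , toℕ-fromℕ< 1+d<n)
  where
  1+d<n = ≤∧≢⇒< (toℕ<n d) 1+d≢n

module DoubleReverse {n} (Γ : RootSet n) (ac : IsAntichain Γ) where
  open Antichain Γ ac

  Δ : RootSet n
  Δ = dual (revOp Γ)

  private
    module RevΓ = Reverse Γ ac
    module Dual𝔛Γ = Dual (revOp Γ) (revOp-antichain Γ)
    module RevΔ = Reverse Δ Dual𝔛Γ.dual-antichain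

  diagonal-Δ : ∀ c → Δ c c ≡ Γ c c
  diagonal-Δ c = bool-ext
    (λ Δcc → decidable-stable (Γ c c ≟ᴮ true) λ Γcc≢true →
       Dual𝔛Γ.dual-diagonal⇒uncovered c Δcc (RevΓ.off-diagonal⇒revOp-covers c Γcc≢true))
    (λ Γcc → Dual𝔛Γ.uncovered⇒dual-diagonal c λ covered → RevΓ.revOp-covers⇒off-diagonal c covered Γcc)

  firstIdx-revOp-Δ : ∀ c → firstIdx (revOp Δ) c ≡ not (J c)
  firstIdx-revOp-Δ c = bool-ext (λ e → not-true⁺ (not-second e)) (λ e → not-second⇒first (not-true⁻ e))
    where
    not-second : firstIdx (revOp Δ) c ≡ true → J c ≢ true
    not-second e c∈J with RevΔ.firstIdx-revOp-true⁻ c e | secondIdx-true⁻ Γ c c∈J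
    ... | start , Δcc≢true | a , g = [ (λ c≡0 → n≮0 (subst (toℕ a <_) c≡0 a<c)) , after ] start
      where
      a<c : toℕ a < toℕ c
      a<c = distinct⇒< g λ a≡c → Δcc≢true (trans (diagonal-Δ c) (subst (λ x → Γ x c ≡ true) a≡c g))
      after : ∃[ c′ ] suc (toℕ c′) ≡ toℕ c × firstIdx Δ c′ ≡ true → ⊥
      after (c′ , 1+c′≡c , Δc′) =
        not-true⁻ (trans (sym (Dual𝔛Γ.firstIdx-dual c′)) Δc′)
          (RevΓ.secondIdx-revOp-true⁺ c′ (inj₂ (c , sym 1+c′≡c , c∈J))
            (diagonal-before-second g a<c 1+c′≡c))

    not-second⇒first : J c ≢ true → firstIdx (revOp Δ) c ≡ true
    not-second⇒first c∉J = RevΔ.firstIdx-revOp-true⁺ c start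
      λ Δcc → c∉J (secondIdx-true⁺ Γ c c (trans (sym (diagonal-Δ c)) Δcc))
      where
      start : FirstOrPredIn (firstIdx Δ) c
      start with zero-or-suc c
      ... | inj₁ c≡0 = inj₁ c≡0
      ... | inj₂ (c′ , 1+c′≡c) = inj₂ (c′ , 1+c′≡c , trans (Dual𝔛Γ.firstIdx-dual c′)
            (not-true⁺ λ J′c′ → [ at-end , before-J ] (proj₁ (RevΓ.secondIdx-revOp-true⁻ c′ J′c′))))
        where
        at-end : suc (toℕ c′) ≡ n → ⊥
        at-end 1+c′≡n = <⇒≢ (toℕ<n c) (trans (sym 1+c′≡c) 1+c′≡n)
        before-J : ∃[ d′ ] toℕ d′ ≡ suc (toℕ c′) × J d′ ≡ true → ⊥
        before-J (d′ , d′≡1+c′ , Jd′) =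
          c∉J (subst (λ x → J x ≡ true) (toℕ-injective (trans d′≡1+c′ 1+c′≡c)) Jd′)

  secondIdx-revOp-Δ : ∀ d → secondIdx (revOp Δ) d ≡ not (I d)
  secondIdx-revOp-Δ d = bool-ext (λ e → not-true⁺ (not-first e)) (λ e → not-first⇒second (not-true⁻ e))
    where
    not-first : secondIdx (revOp Δ) d ≡ true → I d ≢ true
    not-first e d∈I with RevΔ.secondIdx-revOp-true⁻ d e | firstIdx-true⁻ Γ d d∈I
    ... | end , Δdd≢true | b , g =
      [ (λ 1+d≡n → <⇒≱ (toℕ<n b) (subst (_≤ toℕ b) 1+d≡n d<b)) , before ] end
      where
      d<b : toℕ d < toℕ b
      d<b = distinct⇒< g λ d≡b →
        Δdd≢true (trans (diagonal-Δ d) (subst (λ x → Γ d x ≡ true) (sym d≡b) g))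
      before : ∃[ d′ ] toℕ d′ ≡ suc (toℕ d) × secondIdx Δ d′ ≡ true → ⊥
      before (d′ , d′≡1+d , Δd′) =
        not-true⁻ (trans (sym (Dual𝔛Γ.secondIdx-dual d′)) Δd′)
          (RevΓ.firstIdx-revOp-true⁺ d′ (inj₂ (d , sym d′≡1+d , d∈I))
            (diagonal-after-first g d<b d′≡1+d))

    not-first⇒second : I d ≢ true → secondIdx (revOp Δ) d ≡ true
    not-first⇒second d∉I = RevΔ.secondIdx-revOp-true⁺ d end
      λ Δdd → d∉I (firstIdx-true⁺ Γ d d (trans (sym (diagonal-Δ d)) Δdd))
      where
      end : LastOrSuccIn (secondIdx Δ) d
      end with last-or-suc d
      ... | inj₁ 1+d≡n = inj₁ 1+d≡n
      ... | inj₂ (d′ , d′≡1+d) = inj₂ (d′ , d′≡1+d , trans (Dual𝔛Γ.secondIdx-dual d′)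
            (not-true⁺ λ I′d′ → [ at-start , after-I ] (proj₁ (RevΓ.firstIdx-revOp-true⁻ d′ I′d′))))
        where
        at-start : toℕ d′ ≡ 0 → ⊥
        at-start d′≡0 = 1+n≢0 (trans (sym d′≡1+d) d′≡0)
        after-I : ∃[ c′ ] suc (toℕ c′) ≡ toℕ d′ × I c′ ≡ true → ⊥
        after-I (c′ , 1+c′≡d′ , Ic′) =
          d∉I (subst (λ x → I x ≡ true) (toℕ-injective (suc-injective (trans 1+c′≡d′ d′≡1+d))) Ic′)

mainTheorem3 : (n : ℕ) → 1 ≤ n → (Γ : RootSet n) → IsAntichain Γ →
    IsAntichain (dual (revOp Γ)) × (revOp (dual (revOp Γ)) ≐ dual Γ)
mainTheorem3 n _ Γ ac =
  Dual.dual-antichain (revOp Γ) (revOp-antichain Γ) ,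
  antichain-ext (revOp-antichain (dual (revOp Γ))) (Dual.dual-antichain Γ ac)
    (λ c → trans (DoubleReverse.firstIdx-revOp-Δ Γ ac c) (sym (Dual.firstIdx-dual Γ ac c)))
    (λ d → trans (DoubleReverse.secondIdx-revOp-Δ Γ ac d) (sym (Dual.secondIdx-dual Γ ac d)))
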